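{- Let $G$ be a finite undirected connected graph without loops with vertices $v_1,\dots,v_{n+1}$ and sink $v_{n+1}$. Then, as maps on $\mathsf{Stable}(G)$, $\varphi\circ\beta=\beta\circ\psi$.
   Context: $d_i$ is the degree of $v_i$, $e(i,j)\in\{0,1\}$ the edge indicator, $\alpha_i$ the standard basis of $\mathbb{Z}^{n+1}$, $\Delta_i=d_i\alpha_i-\sum_{j\ne i}e(i,j)\alpha_j$, $\Delta_A=\sum_{j\in A}\Delta_j$. Configurations are vectors in $\mathbb{Z}^{n+1}$ modulo the sink coordinate; $c$ is stable if $0\le c_i<d_i$ for $1\le i\le n$; $\mathsf{Stable}(G)$ is the set of stable configurations. $\beta$ is defined by $\beta(c)_i=(d_i-1)-c_i$ for $1\le i\le n$. Subsets of $\{1,\dots,n\}$ are ordered by $A\prec B$ if $|A|<|B|$, or $|A|=|B|$ and $A$'s increasing listing is lexicographically smaller. $\psi(c)=c$ if no nonempty $A\subseteq\{1,\dots,n\}$ has $c+\Delta_A$ stable, otherwise $\psi(c)=c+\Delta_A$ for the $\prec$-minimal such nonempty $A$. $\varphi(c)=c$ if no nonempty $A\subseteq\{1,\dots,n\}$ has $c-\Delta_A$ stable, otherwise $\varphi(c)=c-\Delta_A$ for the $\prec$-minimal such nonempty $A$. -}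

module Defs where

open import Data.Bool using (Bool; true; false; if_then_else_)
open import Data.Nat as ℕ using (ℕ; zero; suc)
import Data.Nat.Properties as ℕP
open import Data.Integer as ℤ using (ℤ; +_; _-_; -_)
import Data.Integer.Properties as ℤP
open import Data.Fin using (Fin; zero; suc; toℕ; inject₁; fromℕ; _≟_)
open import Data.Fin.Properties using (all?)
open import Data.Fin.Subset using (Subset; ∣_∣)
open import Data.List using (List; []; _∷_; map; foldr; filter)
open import Data.Vec using (Vec; []; _∷_)
open import Data.Product using (_×_; _,_)
open import Relation.Nullary using (Dec; yes; no; ¬_)
open import Relation.Nullary.Decidable using (_×-dec_; ⌊_⌋)
open import Relation.Binary.PropositionalEquality using (_≡_)

-- A graph on vertices v_1..v_{n+1} is encoded as Fin (suc n); vertex v_{k+1} is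
-- the element k, so the sink v_{n+1} is  fromℕ n  (the last element) and the
-- non-sink vertex v_{i+1} (i : Fin n) is  inject₁ i.

Adj : ℕ → Set
Adj n = Fin (suc n) → Fin (suc n) → Bool

Symmetric : ∀ {n} → Adj n → Set
Symmetric e = ∀ i j → e i j ≡ e j i

Loopless : ∀ {n} → Adj n → Set
Loopless e = ∀ i → e i i ≡ false

data Reachable {n : ℕ} (e : Adj n) : Fin (suc n) → Fin (suc n) → Set where
  here : ∀ {u} → Reachable e u u
  step : ∀ {u w v} → e u w ≡ true → Reachable e w v → Reachable e u v

Connected : ∀ {n} → Adj n → Set
Connected e = ∀ u v → Reachable e u v

ind : Bool → ℕ
ind true  = 1
ind false = 0

sumFin : ∀ {m} → (Fin m → ℕ) → ℕ
sumFin {zero}  f = 0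
sumFin {suc m} f = f zero ℕ.+ sumFin (λ k → f (suc k))

deg : ∀ {n} → Adj n → Fin (suc n) → ℕ
deg e i = sumFin (λ j → ind (e i j))

-- configurations modulo the sink coordinate: the coordinates 1..n
Config : ℕ → Set
Config n = Fin n → ℤ

d : ∀ {n} → Adj n → Fin n → ℕ
d e i = deg e (inject₁ i)

Stable : ∀ {n} → Adj n → Config n → Set
Stable e c = ∀ i → (+ 0 ℤ.≤ c i) × (c i ℤ.< + d e i)

stable? : ∀ {n} (e : Adj n) (c : Config n) → Dec (Stable e c)
stable? e c = all? (λ i → (+ 0 ℤ.≤? c i) ×-dec (c i ℤ.<? + d e i))

β : ∀ {n} → Adj n → Config n → Config n
β e c i = (+ d e i - + 1) - c i

Δ : ∀ {n} → Adj n → Fin n → Config n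
Δ e j k with j ≟ k
... | yes _ = + d e j
... | no  _ = - (+ ind (e (inject₁ j) (inject₁ k)))

elems : ∀ {m} → Subset m → List (Fin m)
elems []            = []
elems (true  ∷ xs)  = zero ∷ map suc (elems xs)
elems (false ∷ xs)  = map suc (elems xs)

ΔA : ∀ {n} → Adj n → Subset n → Config n
ΔA e A k = foldr (λ j acc → Δ e j k ℤ.+ acc) (+ 0) (elems A)

_⊕_ : ∀ {n} → Config n → Config n → Config n
(c ⊕ c') i = c i ℤ.+ c' i

_⊖_ : ∀ {n} → Config n → Config n → Config n
(c ⊖ c') i = c i ℤ.- c' i

allSubsets : ∀ m → List (Subset m)
allSubsets zero    = [] ∷ []
allSubsets (suc m) = map (true ∷_) (allSubsets m) Data.List.++ map (false ∷_) (allSubsets m)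

Nonempty : ∀ {m} → Subset m → Set
Nonempty A = ¬ (∣ A ∣ ≡ 0)

lexLt : List ℕ → List ℕ → Bool
lexLt []       []       = false
lexLt []       (_ ∷ _)  = true
lexLt (_ ∷ _)  []       = false
lexLt (x ∷ xs) (y ∷ ys) with x ℕ.<? y | x ℕ.≟ y
... | yes _ | _     = true
... | no _  | yes _ = lexLt xs ys
... | no _  | no _  = false

prec : ∀ {m} → Subset m → Subset m → Bool
prec A B with ∣ A ∣ ℕ.<? ∣ B ∣ | ∣ A ∣ ℕ.≟ ∣ B ∣
... | yes _ | _     = true
... | no _  | yes _ = lexLt (map toℕ (elems A)) (map toℕ (elems B))
... | no _  | no _  = false

data Maybe′ (A : Set) : Set where
  none : Maybe′ A
  some : A → Maybe′ A

minPrec : ∀ {m} → List (Subset m) → Maybe′ (Subset m)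
minPrec []       = none
minPrec (A ∷ As) with minPrec As
... | none   = some A
... | some B = if prec B A then some B else some A

minimalA : ∀ {n} → Adj n → (Subset n → Config n) → Maybe′ (Subset n)
minimalA {n} e f =
  minPrec (filter (λ A → (Relation.Nullary.¬? (∣ A ∣ ℕ.≟ 0)) ×-dec stable? e (f A)) (allSubsets n))

ψ : ∀ {n} → Adj n → Config n → Config n
ψ e c with minimalA e (λ A → c ⊕ ΔA e A)
... | none   = c
... | some A = c ⊕ ΔA e A

φ : ∀ {n} → Adj n → Config n → Config n
φ e c with minimalA e (λ A → c ⊖ ΔA e A)
... | none   = c
... | some A = c ⊖ ΔA e A

module Submission where

open import Defs
open import Data.Nat using (ℕ; zero; suc; s≤s; z≤n; _≟_)
open import Data.Nat.Properties using (m∸n≤m)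
open import Data.Integer using (+_; _+_; _-_; _≤_; _<_; +≤+; +<+)
open import Data.Integer.Properties using (m-n≡m⊖n; ⊖-≥)
open import Data.Integer.Tactic.RingSolver using (solve-∀)
open import Data.Fin using (Fin)
open import Data.Fin.Subset using (Subset; ∣_∣)
open import Data.List.Properties using (filter-≐)
open import Data.Product using (_×_; _,_; map₂)
open import Function.Bundles using (_⇔_; mk⇔; Equivalence)
open import Relation.Nullary using (¬?)
open import Relation.Nullary.Decidable using (_×-dec_)
open import Relation.Unary using (Decidable)
open import Relation.Binary.PropositionalEquality using (_≡_; _≗_; refl; sym; cong; subst)

-- β is the reflection z ↦ (d_i − 1) − z of each coordinate, which preserves [0, d_i)
-- and turns  β c − x  into  β (c + x).  So c + Δ_A is stable exactly when β c − Δ_A is,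
-- the searches defining ψ c and φ (β c) select the same A, and the identity
-- (β c) − Δ_A = β (c + Δ_A)  finishes the proof.

reflect-preserves-range : ∀ m z → + 0 ≤ z × z < + m →
  + 0 ≤ (+ m - + 1) - z × (+ m - + 1) - z < + m
reflect-preserves-range zero    (+ k) (_ , +<+ ())
reflect-preserves-range (suc m) (+ k) (_ , +<+ (s≤s k≤m))
  rewrite m-n≡m⊖n m k | ⊖-≥ k≤m = +≤+ z≤n , +<+ (s≤s (m∸n≤m m k))

β-involutive : ∀ {n} (e : Adj n) (c : Config n) → β e (β e c) ≗ c
β-involutive e c i = a-[a-b]≡b (+ d e i - + 1) (c i)
  where
  a-[a-b]≡b : ∀ a b → a - (a - b) ≡ b
  a-[a-b]≡b = solve-∀

β-⊖ : ∀ {n} (e : Adj n) (c x : Config n) → β e c ⊖ x ≗ β e (c ⊕ x)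
β-⊖ e c x i = [a-b]-c≡a-[b+c] (+ d e i - + 1) (c i) (x i)
  where
  [a-b]-c≡a-[b+c] : ∀ a b c → (a - b) - c ≡ a - (b + c)
  [a-b]-c≡a-[b+c] = solve-∀

Stable-resp-≗ : ∀ {n} (e : Adj n) {x y : Config n} → x ≗ y → Stable e x → Stable e y
Stable-resp-≗ e x≗y s i = subst (λ z → + 0 ≤ z × z < + d e i) (x≗y i) (s i)

β-stable : ∀ {n} (e : Adj n) {c : Config n} → Stable e c → Stable e (β e c)
β-stable e {c} s i = reflect-preserves-range (d e i) (c i) (s i)

β-stable⇔ : ∀ {n} (e : Adj n) (c : Config n) → Stable e (β e c) ⇔ Stable e c
β-stable⇔ e c = mk⇔ (λ s → Stable-resp-≗ e (β-involutive e c) (β-stable e s)) (β-stable e)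

β⊖-stable⇔⊕-stable : ∀ {n} (e : Adj n) (c x : Config n) →
  Stable e (β e c ⊖ x) ⇔ Stable e (c ⊕ x)
β⊖-stable⇔⊕-stable e c x = mk⇔
  (λ s → Equivalence.to (β-stable⇔ e (c ⊕ x)) (Stable-resp-≗ e (β-⊖ e c x) s))
  (λ s → Stable-resp-≗ e (λ i → sym (β-⊖ e c x i)) (β-stable e s))

minimalA-cong : ∀ {n} (e : Adj n) (f g : Subset n → Config n) →
  (∀ A → Stable e (f A) ⇔ Stable e (g A)) → minimalA e f ≡ minimalA e g
minimalA-cong {n} e f g f⇔g = cong minPrec (filter-≐ (admissible? f) (admissible? g)
  (map₂ (Equivalence.to (f⇔g _)) , map₂ (Equivalence.from (f⇔g _))) (allSubsets n))
  where
  admissible? : (h : Subset n → Config n) → Decidable (λ A → Nonempty A × Stable e (h A))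
  admissible? h A = ¬? (∣ A ∣ ≟ 0) ×-dec stable? e (h A)

proposition2p12 : (n : ℕ) (e : Adj n) → Symmetric e → Loopless e → Connected e →
    (c : Config n) → Stable e c → (i : Fin n) → φ e (β e c) i ≡ β e (ψ e c) i
proposition2p12 n e _ _ _ c _ i
  with minimalA e (λ A → β e c ⊖ ΔA e A) | minimalA e (λ A → c ⊕ ΔA e A)
     | minimalA-cong e _ _ (λ A → β⊖-stable⇔⊕-stable e c (ΔA e A))
... | none   | .none     | refl = refl
... | some A | .(some A) | refl = β-⊖ e c (ΔA e A) i
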